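{- The cohort of a non-empty arch system $A$ is a singleton if and only if one of the following holds: (i) $A = b^k$ (the concatenation of $k$ copies of $b$) where $k\ge 3$ and $b$ is an atom which is the only atom in its cohort; or (ii) $A = a^2$ where $a$ is an atom whose contents are some $b^k$ as in (i); or (iii) $A$ is an atom whose contents are either empty or some $b^k$ as in (i). Moreover, the atoms which are the only atom in their cohort are exactly: the single arch $\langle\,\rangle$, and the atoms whose (non-empty) contents belong to a singleton cohort.
   Context: An arch system of size $n$ is a set of $n$ non-crossing arches above a baseline connecting $2n$ points, each point an endpoint of exactly one arch; the empty system has size $0$. Concatenation $AB$ places $B$ right of $A$. An atom is a non-empty arch system that is not a concatenation of two non-empty ones; every atom is $\langle A\rangle$, obtained from its contents $A$ by adding one enclosing arch; $\langle\,\rangle$ is the single arch. The relation $\sim$ is the finest equivalence relation on arch systems such that for all arch systems $A,B,P,Q$ and all $a,b,c$ each an atom or empty: (R1) $A\sim B\Rightarrow\langle A\rangle\sim\langle B\rangle$; (R2) $a\sim b\Rightarrow PaQ\sim PbQ$; (R3) $PabQ\sim PbaQ$; (R4) $a\langle bc\rangle\sim\langle ab\rangle c$. Its equivalence classes are called cohorts; a singleton cohort is one containing exactly one arch system. -}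

module Defs where

open import Data.List using (List; []; _∷_; _++_; replicate; length)
open import Data.Nat using (ℕ; _≤_; _≥_)
open import Data.Product using (Σ; _×_; ∃-syntax)
open import Data.Sum using (_⊎_)
open import Relation.Binary.PropositionalEquality using (_≡_)
open import Relation.Nullary using (¬_)

-- An atom ⟨A⟩ is represented by its contents A; an arch system is the
-- list of its atoms (from left to right).  Concatenation is _++_.
data Atom : Set where
  ⟨_⟩ : List Atom → Atom

ArchSystem : Set
ArchSystem = List Atom

contents : Atom → ArchSystem
contents ⟨ A ⟩ = A

atom : Atom → ArchSystem
atom t = t ∷ []

AtomOrEmpty : ArchSystem → Set
AtomOrEmpty a = length a ≤ 1

data _∼_ : ArchSystem → ArchSystem → Set where
  ∼-refl  : ∀ {A} → A ∼ A
  ∼-sym   : ∀ {A B} → A ∼ B → B ∼ A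
  ∼-trans : ∀ {A B C} → A ∼ B → B ∼ C → A ∼ C
  R1 : ∀ {A B} → A ∼ B → atom ⟨ A ⟩ ∼ atom ⟨ B ⟩
  R2 : ∀ {a b} (P Q : ArchSystem) → AtomOrEmpty a → AtomOrEmpty b →
       a ∼ b → (P ++ a ++ Q) ∼ (P ++ b ++ Q)
  R3 : ∀ {a b} (P Q : ArchSystem) → AtomOrEmpty a → AtomOrEmpty b →
       (P ++ a ++ b ++ Q) ∼ (P ++ b ++ a ++ Q)
  R4 : ∀ {a b c} → AtomOrEmpty a → AtomOrEmpty b → AtomOrEmpty c →
       (a ++ atom ⟨ b ++ c ⟩) ∼ (atom ⟨ a ++ b ⟩ ++ c)

SingletonCohort : ArchSystem → Set
SingletonCohort A = ∀ B → B ∼ A → B ≡ A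

OnlyAtomInCohort : Atom → Set
OnlyAtomInCohort t = ∀ u → atom u ∼ atom t → u ≡ t

IsPowerCase : ArchSystem → Set
IsPowerCase A = Σ Atom λ b → Σ ℕ λ k →
  (k ≥ 3) × OnlyAtomInCohort b × (A ≡ replicate k b)

NonEmpty : ArchSystem → Set
NonEmpty A = ¬ (A ≡ [])

-- A predicate on arch systems closed under R1–R4 contains the whole cohort of each of its
-- members, so cohorts are bounded by exhibiting such invariants.  In a singleton cohort R3
-- forces all atoms to be equal and R2 forces each of them to be the only atom in its cohort,
-- while R4 excludes the atoms ⟨x⟩, ⟨xy⟩ and the squares ⟨⟩⟨⟩, ⟨x⟩⟨x⟩, ⟨xy⟩⟨xy⟩.  Conversely,
-- R4 only rewrites systems of at most two atoms and only opens or closes atoms with at most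
-- two atoms inside, so it never touches b^k (k ≥ 3), nor a wide atom (one with at least
-- three atoms inside) or its square; hence these, and ⟨⟩, are alone in their cohorts.
-- Finally ⟨⟨D⟩⟩ and ⟨⟨D⟩⟨D⟩⟩ (with ⟨D⟩ hollow or wide) are not singletons, but their
-- cohorts {⟨a⟩, a⟨⟩, ⟨⟩a} and {⟨aa⟩, a⟨a⟩, ⟨a⟩a}, where a = ⟨D⟩, contain no other atom.

module Submission where

open import Defs
open import Data.List using ([]; _∷_; _++_; replicate; length)
open import Data.List.Properties using (++-assoc; ++-cancelˡ; ++-identityʳ; ∷-injectiveˡ)
open import Data.List.Relation.Unary.All as All using (All; []; _∷_)
open import Data.List.Relation.Unary.All.Properties using (++⁻ʳ; replicate⁺)
open import Data.Nat using (suc; _+_; _≤_; z≤n; s≤s)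
open import Data.Nat.Properties using (≤⇒≯)
open import Data.Product using (Σ; _×_; _,_; proj₁; proj₂; swap)
open import Data.Sum using (_⊎_; inj₁; inj₂)
open import Data.Empty using (⊥-elim)
open import Function using (id; _∘_)
open import Function.Bundles using (_⇔_; mk⇔)
open import Relation.Nullary using (¬_)
open import Relation.Binary.PropositionalEquality using (_≡_; refl; sym; cong; subst)

-- R2 rewrites along an already derived a ∼ b, along which S may therefore be assumed preserved.
R1-Closed R2-Closed R3-Closed R4-Closed : (ArchSystem → Set) → Set
R1-Closed S = ∀ {A B} → A ∼ B → S (atom ⟨ A ⟩) → S (atom ⟨ B ⟩)
R2-Closed S = ∀ P a b Q → AtomOrEmpty a → AtomOrEmpty b → a ∼ b → (S a → S b) →
              S (P ++ a ++ Q) → S (P ++ b ++ Q)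
R3-Closed S = ∀ P a b Q → AtomOrEmpty a → AtomOrEmpty b →
              S (P ++ a ++ b ++ Q) → S (P ++ b ++ a ++ Q)
R4-Closed S = ∀ a b c → AtomOrEmpty a → AtomOrEmpty b → AtomOrEmpty c →
              (S (a ++ atom ⟨ b ++ c ⟩) → S (atom ⟨ a ++ b ⟩ ++ c))
              × (S (atom ⟨ a ++ b ⟩ ++ c) → S (a ++ atom ⟨ b ++ c ⟩))

record Invariant (S : ArchSystem → Set) : Set where
  field
    r1 : R1-Closed S
    r2 : R2-Closed S
    r3 : R3-Closed S
    r4 : R4-Closed S

module _ {S : ArchSystem → Set} (inv : Invariant S) where
  open Invariant inv

  ∼-preserves : ∀ {A B} → A ∼ B → (S A → S B) × (S B → S A)
  ∼-preserves ∼-refl        = id , id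
  ∼-preserves (∼-sym p)     = swap (∼-preserves p)
  ∼-preserves (∼-trans p q) = proj₁ (∼-preserves q) ∘ proj₁ (∼-preserves p)
                            , proj₂ (∼-preserves p) ∘ proj₂ (∼-preserves q)
  ∼-preserves (R1 p)        = r1 p , r1 (∼-sym p)
  ∼-preserves (R2 {a} {b} P Q ha hb p) =
    r2 P a b Q ha hb p (proj₁ (∼-preserves p)) , r2 P b a Q hb ha (∼-sym p) (proj₂ (∼-preserves p))
  ∼-preserves (R3 {a} {b} P Q ha hb) = r3 P a b Q ha hb , r3 P b a Q hb ha
  ∼-preserves (R4 {a} {b} {c} ha hb hc) = r4 a b c ha hb hc

  cohort-⊆ : ∀ {A B} → S A → B ∼ A → S B
  cohort-⊆ sA p = proj₂ (∼-preserves p) sA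

singleton-by-invariant : ∀ {W} → Invariant (_≡ W) → SingletonCohort W
singleton-by-invariant inv B p = cohort-⊆ inv refl p

empty-invariant : Invariant (_≡ [])
Invariant.r1 empty-invariant _ ()
Invariant.r2 empty-invariant [] [] b Q _ _ _ ih h with ih refl
... | refl = h
Invariant.r2 empty-invariant [] (_ ∷ _) _ _ _ _ _ _ ()
Invariant.r2 empty-invariant (_ ∷ _) _ _ _ _ _ _ _ ()
Invariant.r3 empty-invariant [] [] [] Q _ _ h = h
Invariant.r3 empty-invariant [] [] (_ ∷ _) _ _ _ ()
Invariant.r3 empty-invariant [] (_ ∷ _) _ _ _ _ ()
Invariant.r3 empty-invariant (_ ∷ _) _ _ _ _ _ ()
Invariant.r4 empty-invariant [] _ _ _ _ _ = (λ ()) , (λ ())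
Invariant.r4 empty-invariant (_ ∷ _) _ _ _ _ _ = (λ ()) , (λ ())

singleton-[] : SingletonCohort []
singleton-[] = singleton-by-invariant empty-invariant

data Wide : Atom → Set where
  wide : ∀ {x y z C} → Wide ⟨ x ∷ y ∷ z ∷ C ⟩

data HollowOrWide : Atom → Set where
  hollow : HollowOrWide ⟨ [] ⟩
  wide   : ∀ {x y z C} → HollowOrWide ⟨ x ∷ y ∷ z ∷ C ⟩

onlyAtom-head : ∀ {t R} → SingletonCohort (t ∷ R) → OnlyAtomInCohort t
onlyAtom-head {R = R} s u p = ∷-injectiveˡ (s (u ∷ R) (R2 [] R (s≤s z≤n) (s≤s z≤n) p))

contents-singleton : ∀ {C} → OnlyAtomInCohort ⟨ C ⟩ → SingletonCohort C
contents-singleton oa B p = cong contents (oa ⟨ B ⟩ (R1 p))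

adjacent-equal : ∀ P {x y Q} → SingletonCohort (P ++ x ∷ y ∷ Q) → x ≡ y
adjacent-equal P {x} {y} {Q} s =
  sym (∷-injectiveˡ (++-cancelˡ P _ _ (s _ (R3 {a = atom y} {b = atom x} P Q (s≤s z≤n) (s≤s z≤n)))))

constant-tail : ∀ P {t} L → SingletonCohort (P ++ t ∷ L) → All (_≡ t) L
constant-tail P []      _ = []
constant-tail P {t} (_ ∷ L) s with adjacent-equal P s
... | refl = refl ∷ constant-tail (P ++ t ∷ []) L
                      (subst SingletonCohort (sym (++-assoc P (t ∷ []) (t ∷ L))) s)

constant⇒replicate : ∀ {A : Set} {x : A} xs → All (_≡ x) xs → xs ≡ replicate (length xs) x
constant⇒replicate []      []            = refl
constant⇒replicate (_ ∷ xs) (refl ∷ same) = cong (_ ∷_) (constant⇒replicate xs same)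

power-of-singleton : ∀ {x y z R} → SingletonCohort (x ∷ y ∷ z ∷ R) → IsPowerCase (x ∷ y ∷ z ∷ R)
power-of-singleton {x} {y} {z} {R} s =
  x , 3 + length R , s≤s (s≤s (s≤s z≤n)) , onlyAtom-head s ,
  cong (x ∷_) (constant⇒replicate (y ∷ z ∷ R) (constant-tail [] (y ∷ z ∷ R) s))

singleton-atom-hollowOrWide : ∀ {t} → SingletonCohort (atom t) → HollowOrWide t
singleton-atom-hollowOrWide {⟨ [] ⟩} _ = hollow
singleton-atom-hollowOrWide {⟨ x ∷ [] ⟩} s
  with s _ (R4 {a = x ∷ []} {b = []} {c = []} (s≤s z≤n) z≤n z≤n)
... | ()
singleton-atom-hollowOrWide {⟨ x ∷ y ∷ [] ⟩} s
  with s _ (R4 {a = x ∷ []} {b = y ∷ []} {c = []} (s≤s z≤n) (s≤s z≤n) z≤n)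
... | ()
singleton-atom-hollowOrWide {⟨ _ ∷ _ ∷ _ ∷ _ ⟩} _ = wide

singleton-square-wide : ∀ {t} → SingletonCohort (t ∷ t ∷ []) → Wide t
singleton-square-wide {⟨ [] ⟩} s
  with s _ (∼-sym (R4 {a = ⟨ [] ⟩ ∷ []} {b = []} {c = []} (s≤s z≤n) z≤n z≤n))
... | ()
singleton-square-wide {⟨ p ∷ [] ⟩} s
  with s _ (∼-sym (R4 {a = ⟨ p ∷ [] ⟩ ∷ []} {b = p ∷ []} {c = []} (s≤s z≤n) (s≤s z≤n) z≤n))
... | ()
singleton-square-wide {⟨ p ∷ q ∷ [] ⟩} s
  with s _ (∼-sym (R4 {a = ⟨ p ∷ q ∷ [] ⟩ ∷ []} {b = p ∷ []} {c = q ∷ []}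
                       (s≤s z≤n) (s≤s z≤n) (s≤s z≤n)))
... | ()
singleton-square-wide {⟨ _ ∷ _ ∷ _ ∷ _ ⟩} _ = wide

SingletonShape : ArchSystem → Set
SingletonShape A =
  IsPowerCase A
  ⊎ (Σ Atom λ a → IsPowerCase (contents a) × (A ≡ a ∷ a ∷ []))
  ⊎ (Σ Atom λ a → (contents a ≡ [] ⊎ IsPowerCase (contents a)) × (A ≡ atom a))

shape-of-singleton : ∀ A → NonEmpty A → SingletonCohort A → SingletonShape A
shape-of-singleton [] ne _ = ⊥-elim (ne refl)
shape-of-singleton (t ∷ []) _ s with singleton-atom-hollowOrWide s
... | hollow = inj₂ (inj₂ (t , inj₁ refl , refl))
... | wide   = inj₂ (inj₂ (t , inj₂ (power-of-singleton (contents-singleton (onlyAtom-head s))) , refl))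
shape-of-singleton (t ∷ _ ∷ []) _ s with adjacent-equal [] s
... | refl with singleton-square-wide s
...   | wide = inj₂ (inj₁ (t , power-of-singleton (contents-singleton (onlyAtom-head s)) , refl))
shape-of-singleton (_ ∷ _ ∷ _ ∷ _) _ s = inj₁ (power-of-singleton s)

onlyAtom-rigid : ∀ {x b} → OnlyAtomInCohort x → AtomOrEmpty b → atom x ∼ b → b ≡ atom x
onlyAtom-rigid {b = []} _ _ p with singleton-[] _ p
... | ()
onlyAtom-rigid {b = y ∷ []} ox _ p = cong atom (ox y (∼-sym p))
onlyAtom-rigid {b = _ ∷ _ ∷ _} _ (s≤s ()) _

atom-in-context : ∀ P {x Q w} → P ++ x ∷ Q ≡ atom w → P ≡ [] × Q ≡ []
atom-in-context [] refl = refl , refl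
atom-in-context (_ ∷ []) ()
atom-in-context (_ ∷ _ ∷ _) ()

r2-closed : ∀ {S} → (∀ {X} → S X → All OnlyAtomInCohort X ⊎ Σ Atom λ w → X ≡ atom w) →
            R2-Closed S
r2-closed {S} _ P [] b Q _ _ p _ h = subst (λ b → S (P ++ b ++ Q)) (sym (singleton-[] _ (∼-sym p))) h
r2-closed {S} kind P (_ ∷ []) b Q _ hb p ih h with kind h
... | inj₁ onlyAtoms with ++⁻ʳ P onlyAtoms
...   | ox ∷ _ = subst (λ b → S (P ++ b ++ Q)) (sym (onlyAtom-rigid ox hb p)) h
r2-closed {S} kind P (_ ∷ []) b Q _ hb p ih h | inj₂ (_ , eq) with atom-in-context P eq
... | refl , refl = subst S (sym (++-identityʳ b)) (ih h)
r2-closed _ _ (_ ∷ _ ∷ _) _ _ (s≤s ()) _ _ _ _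

r3-closed-constant : ∀ {W c} → All (_≡ c) W → R3-Closed (_≡ W)
r3-closed-constant _ _ [] _ _ _ _ h = h
r3-closed-constant _ _ (_ ∷ []) [] _ _ _ h = h
r3-closed-constant same P (x ∷ []) (y ∷ []) Q _ _ refl with ++⁻ʳ P same
... | refl ∷ refl ∷ _ = refl
r3-closed-constant _ _ (_ ∷ []) (_ ∷ _ ∷ _) _ _ (s≤s ()) _
r3-closed-constant _ _ (_ ∷ _ ∷ _) _ _ (s≤s ()) _ _

narrow : ∀ b c → AtomOrEmpty b → AtomOrEmpty c → ¬ Wide ⟨ b ++ c ⟩
narrow []          []          _ _ ()
narrow []          (_ ∷ [])    _ _ ()
narrow (_ ∷ [])    []          _ _ ()
narrow (_ ∷ [])    (_ ∷ [])    _ _ ()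
narrow []          (_ ∷ _ ∷ _) _ (s≤s ())
narrow (_ ∷ [])    (_ ∷ _ ∷ _) _ (s≤s ())
narrow (_ ∷ _ ∷ _) _           (s≤s ()) _

length-++-atom : ∀ a t → AtomOrEmpty a → length (a ++ atom t) ≤ 2
length-++-atom []          _ _        = s≤s z≤n
length-++-atom (_ ∷ [])    _ _        = s≤s (s≤s z≤n)
length-++-atom (_ ∷ _ ∷ _) _ (s≤s ())

r4-closed-long : ∀ {W} → 3 ≤ length W → R4-Closed (_≡ W)
r4-closed-long long a _ _ ha _ hc =
  (λ { refl → ⊥-elim (≤⇒≯ (length-++-atom a _ ha) long) }) ,
  (λ { refl → ⊥-elim (≤⇒≯ (s≤s hc) long) })

r4-closed-wide : ∀ {W} → All Wide W → R4-Closed (_≡ W)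
r4-closed-wide wides a b c ha hb hc =
  (λ { refl → ⊥-elim (narrow b c hb hc (All.head (++⁻ʳ a wides))) }) ,
  (λ { refl → ⊥-elim (narrow a b ha hb (All.head wides)) })

r4-closed-hollow : R4-Closed (_≡ atom ⟨ [] ⟩)
r4-closed-hollow []          []      []      _ _ _ = id , id
r4-closed-hollow []          []      (_ ∷ _) _ _ _ = (λ ()) , (λ ())
r4-closed-hollow []          (_ ∷ _) _       _ _ _ = (λ ()) , (λ ())
r4-closed-hollow (_ ∷ [])    _       _       _ _ _ = (λ ()) , (λ ())
r4-closed-hollow (_ ∷ _ ∷ _) _       _       (s≤s ()) _ _

atom-invariant : ∀ {C} → HollowOrWide ⟨ C ⟩ → SingletonCohort C → Invariant (_≡ atom ⟨ C ⟩)
Invariant.r1 (atom-invariant _ s) p refl = cong (atom ∘ ⟨_⟩) (s _ (∼-sym p))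
Invariant.r2 (atom-invariant _ _) = r2-closed λ { refl → inj₂ (_ , refl) }
Invariant.r3 (atom-invariant _ _) = r3-closed-constant (refl ∷ [])
Invariant.r4 (atom-invariant hollow _) = r4-closed-hollow
Invariant.r4 (atom-invariant wide _)   = r4-closed-wide (wide ∷ [])

constant-invariant : ∀ {b} m → OnlyAtomInCohort b → R4-Closed (_≡ replicate (2 + m) b) →
                     Invariant (_≡ replicate (2 + m) b)
Invariant.r1 (constant-invariant _ _ _) _ ()
Invariant.r2 (constant-invariant m ob _) = r2-closed λ { refl → inj₁ (replicate⁺ (2 + m) ob) }
Invariant.r3 (constant-invariant m _ _)  = r3-closed-constant (replicate⁺ (2 + m) refl)
Invariant.r4 (constant-invariant _ _ r4) = r4

power-wide : ∀ {C} → IsPowerCase C → Wide ⟨ C ⟩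
power-wide (_ , _ , s≤s (s≤s (s≤s _)) , _ , refl) = wide

power-singleton : ∀ {C} → IsPowerCase C → SingletonCohort C
power-singleton (_ , _ , s≤s (s≤s (s≤s {n = m} _)) , ob , refl) =
  singleton-by-invariant (constant-invariant (suc m) ob (r4-closed-long (s≤s (s≤s (s≤s z≤n)))))

atom-singleton : ∀ {C} → HollowOrWide ⟨ C ⟩ → SingletonCohort C → SingletonCohort (atom ⟨ C ⟩)
atom-singleton hw s = singleton-by-invariant (atom-invariant hw s)

hollowOrWide-of : ∀ {C} → C ≡ [] ⊎ IsPowerCase C → HollowOrWide ⟨ C ⟩
hollowOrWide-of (inj₁ refl) = hollow
hollowOrWide-of (inj₂ pc) with power-wide pc
... | wide = wide

enclosed-singleton : ∀ {C} → C ≡ [] ⊎ IsPowerCase C → SingletonCohort (atom ⟨ C ⟩)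
enclosed-singleton (inj₁ refl) = atom-singleton hollow singleton-[]
enclosed-singleton (inj₂ pc)   = atom-singleton (hollowOrWide-of (inj₂ pc)) (power-singleton pc)

square-singleton : ∀ {C} → IsPowerCase C → SingletonCohort (⟨ C ⟩ ∷ ⟨ C ⟩ ∷ [])
square-singleton pc = singleton-by-invariant (constant-invariant 0
  (onlyAtom-head (enclosed-singleton (inj₂ pc))) (r4-closed-wide (power-wide pc ∷ power-wide pc ∷ [])))

singleton-of-shape : ∀ {A} → SingletonShape A → SingletonCohort A
singleton-of-shape (inj₁ pc)                                    = power-singleton pc
singleton-of-shape (inj₂ (inj₁ (⟨ _ ⟩ , pc , refl)))            = square-singleton pc
singleton-of-shape (inj₂ (inj₂ (⟨ _ ⟩ , hollowOrPower , refl))) = enclosed-singleton hollowOrPower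

data Trio (w u v : Atom) : ArchSystem → Set where
  [w]   : Trio w u v (w ∷ [])
  [u,v] : Trio w u v (u ∷ v ∷ [])
  [v,u] : Trio w u v (v ∷ u ∷ [])

r3-closed-trio : ∀ {w u v} → R3-Closed (Trio w u v)
r3-closed-trio _ []                _           _ _ _ h     = h
r3-closed-trio _ (_ ∷ [])          []          _ _ _ h     = h
r3-closed-trio [] (_ ∷ []) (_ ∷ []) []      _ _ [u,v] = [v,u]
r3-closed-trio [] (_ ∷ []) (_ ∷ []) []      _ _ [v,u] = [u,v]
r3-closed-trio [] (_ ∷ []) (_ ∷ []) (_ ∷ _) _ _ ()
r3-closed-trio (_ ∷ [])        (_ ∷ []) (_ ∷ []) _ _ _ ()
r3-closed-trio (_ ∷ _ ∷ [])    (_ ∷ []) (_ ∷ []) _ _ _ ()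
r3-closed-trio (_ ∷ _ ∷ _ ∷ _) (_ ∷ []) (_ ∷ []) _ _ _ ()
r3-closed-trio _ (_ ∷ [])    (_ ∷ _ ∷ _) _ _ (s≤s ()) _
r3-closed-trio _ (_ ∷ _ ∷ _) _           _ (s≤s ()) _ _

trio-invariant : ∀ {C u v} → SingletonCohort C → OnlyAtomInCohort u → OnlyAtomInCohort v →
                 R4-Closed (Trio ⟨ C ⟩ u v) → Invariant (Trio ⟨ C ⟩ u v)
Invariant.r1 (trio-invariant s _ _ _) p [w] with s _ (∼-sym p)
... | refl = [w]
Invariant.r2 (trio-invariant _ ou ov _) = r2-closed λ
  { [w] → inj₂ (_ , refl) ; [u,v] → inj₁ (ou ∷ ov ∷ []) ; [v,u] → inj₁ (ov ∷ ou ∷ []) }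
Invariant.r3 (trio-invariant _ _ _ _) = r3-closed-trio
Invariant.r4 (trio-invariant _ _ _ r4) = r4

trio-onlyAtom : ∀ {C u v} → SingletonCohort C → OnlyAtomInCohort u → OnlyAtomInCohort v →
                R4-Closed (Trio ⟨ C ⟩ u v) → OnlyAtomInCohort ⟨ C ⟩
trio-onlyAtom s ou ov r4 _ p with cohort-⊆ (trio-invariant s ou ov r4) [w] p
... | [w] = refl

peel-shift : ∀ {t} → HollowOrWide t → ∀ a b c → AtomOrEmpty a → AtomOrEmpty b → AtomOrEmpty c →
             Trio ⟨ t ∷ [] ⟩ t ⟨ [] ⟩ (a ++ atom ⟨ b ++ c ⟩) →
             Trio ⟨ t ∷ [] ⟩ t ⟨ [] ⟩ (atom ⟨ a ++ b ⟩ ++ c)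
peel-shift _  []       []       []       _ _ _ h     = h
peel-shift _  []       []       (_ ∷ []) _ _ _ [w]   = [v,u]
peel-shift _  []       (_ ∷ []) []       _ _ _ h     = h
peel-shift _  []       (_ ∷ []) (_ ∷ []) _ _ _ ()
peel-shift _  (_ ∷ []) []       []       _ _ _ [u,v] = [w]
peel-shift _  (_ ∷ []) []       []       _ _ _ [v,u] = [w]
peel-shift () (_ ∷ []) []       (_ ∷ []) _ _ _ [v,u]
peel-shift () (_ ∷ []) (_ ∷ []) []       _ _ _ [v,u]
peel-shift () (_ ∷ []) (_ ∷ []) (_ ∷ []) _ _ _ [v,u]
peel-shift _  (_ ∷ _ ∷ _) _     _        (s≤s ()) _ _ _
peel-shift _  _        (_ ∷ _ ∷ _) _     _ (s≤s ()) _ _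
peel-shift _  _        _     (_ ∷ _ ∷ _) _ _ (s≤s ()) _

peel-unshift : ∀ {t} → HollowOrWide t → ∀ a b c → AtomOrEmpty a → AtomOrEmpty b → AtomOrEmpty c →
               Trio ⟨ t ∷ [] ⟩ t ⟨ [] ⟩ (atom ⟨ a ++ b ⟩ ++ c) →
               Trio ⟨ t ∷ [] ⟩ t ⟨ [] ⟩ (a ++ atom ⟨ b ++ c ⟩)
peel-unshift _  []       []       []       _ _ _ h     = h
peel-unshift _  []       []       (_ ∷ []) _ _ _ [u,v] = [w]
peel-unshift _  []       []       (_ ∷ []) _ _ _ [v,u] = [w]
peel-unshift _  []       (_ ∷ []) []       _ _ _ h     = h
peel-unshift () []       (_ ∷ []) (_ ∷ []) _ _ _ [u,v]
peel-unshift _  (_ ∷ []) []       []       _ _ _ [w]   = [u,v]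
peel-unshift () (_ ∷ []) []       (_ ∷ []) _ _ _ [u,v]
peel-unshift _  (_ ∷ []) (_ ∷ []) []       _ _ _ ()
peel-unshift () (_ ∷ []) (_ ∷ []) (_ ∷ []) _ _ _ [u,v]
peel-unshift _  (_ ∷ _ ∷ _) _     _        (s≤s ()) _ _ _
peel-unshift _  _        (_ ∷ _ ∷ _) _     _ (s≤s ()) _ _
peel-unshift _  _        _     (_ ∷ _ ∷ _) _ _ (s≤s ()) _

double-shift : ∀ {t} → Wide t → ∀ a b c → AtomOrEmpty a → AtomOrEmpty b → AtomOrEmpty c →
               Trio ⟨ t ∷ t ∷ [] ⟩ t ⟨ t ∷ [] ⟩ (a ++ atom ⟨ b ++ c ⟩) →
               Trio ⟨ t ∷ t ∷ [] ⟩ t ⟨ t ∷ [] ⟩ (atom ⟨ a ++ b ⟩ ++ c)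
double-shift _  []       []       []       _ _ _ h     = h
double-shift _  []       []       (_ ∷ []) _ _ _ ()
double-shift _  []       (_ ∷ []) []       _ _ _ h     = h
double-shift _  []       (_ ∷ []) (_ ∷ []) _ _ _ [w]   = [v,u]
double-shift () (_ ∷ []) []       []       _ _ _ [v,u]
double-shift _  (_ ∷ []) []       (_ ∷ []) _ _ _ [u,v] = [v,u]
double-shift () (_ ∷ []) []       (_ ∷ []) _ _ _ [v,u]
double-shift _  (_ ∷ []) (_ ∷ []) []       _ _ _ [u,v] = [w]
double-shift () (_ ∷ []) (_ ∷ []) []       _ _ _ [v,u]
double-shift () (_ ∷ []) (_ ∷ []) (_ ∷ []) _ _ _ [v,u]
double-shift _  (_ ∷ _ ∷ _) _     _        (s≤s ()) _ _ _
double-shift _  _        (_ ∷ _ ∷ _) _     _ (s≤s ()) _ _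
double-shift _  _        _     (_ ∷ _ ∷ _) _ _ (s≤s ()) _

double-unshift : ∀ {t} → Wide t → ∀ a b c → AtomOrEmpty a → AtomOrEmpty b → AtomOrEmpty c →
                 Trio ⟨ t ∷ t ∷ [] ⟩ t ⟨ t ∷ [] ⟩ (atom ⟨ a ++ b ⟩ ++ c) →
                 Trio ⟨ t ∷ t ∷ [] ⟩ t ⟨ t ∷ [] ⟩ (a ++ atom ⟨ b ++ c ⟩)
double-unshift _  []       []       []       _ _ _ h     = h
double-unshift () []       []       (_ ∷ []) _ _ _ [u,v]
double-unshift _  []       (_ ∷ []) []       _ _ _ h     = h
double-unshift () []       (_ ∷ []) (_ ∷ []) _ _ _ [u,v]
double-unshift _  []       (_ ∷ []) (_ ∷ []) _ _ _ [v,u] = [w]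
double-unshift _  (_ ∷ []) []       []       _ _ _ ()
double-unshift () (_ ∷ []) []       (_ ∷ []) _ _ _ [u,v]
double-unshift _  (_ ∷ []) []       (_ ∷ []) _ _ _ [v,u] = [u,v]
double-unshift _  (_ ∷ []) (_ ∷ []) []       _ _ _ [w]   = [u,v]
double-unshift () (_ ∷ []) (_ ∷ []) (_ ∷ []) _ _ _ [u,v]
double-unshift _  (_ ∷ _ ∷ _) _     _        (s≤s ()) _ _ _
double-unshift _  _        (_ ∷ _ ∷ _) _     _ (s≤s ()) _ _
double-unshift _  _        _     (_ ∷ _ ∷ _) _ _ (s≤s ()) _

r4-closed-peel : ∀ {t} → HollowOrWide t → R4-Closed (Trio ⟨ t ∷ [] ⟩ t ⟨ [] ⟩)
r4-closed-peel hw a b c ha hb hc = peel-shift hw a b c ha hb hc , peel-unshift hw a b c ha hb hc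

r4-closed-double : ∀ {t} → Wide t → R4-Closed (Trio ⟨ t ∷ t ∷ [] ⟩ t ⟨ t ∷ [] ⟩)
r4-closed-double w a b c ha hb hc = double-shift w a b c ha hb hc , double-unshift w a b c ha hb hc

onlyAtom-⟨⟩ : OnlyAtomInCohort ⟨ [] ⟩
onlyAtom-⟨⟩ = onlyAtom-head (enclosed-singleton (inj₁ refl))

onlyAtom-peeled : ∀ {t} → HollowOrWide t → SingletonCohort (atom t) → OnlyAtomInCohort ⟨ atom t ⟩
onlyAtom-peeled hw s = trio-onlyAtom s (onlyAtom-head s) onlyAtom-⟨⟩ (r4-closed-peel hw)

onlyAtom-doubled : ∀ {t} → Wide t → SingletonCohort (t ∷ t ∷ []) → OnlyAtomInCohort ⟨ t ∷ t ∷ [] ⟩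
onlyAtom-doubled wide s = trio-onlyAtom s (onlyAtom-head s)
  (onlyAtom-peeled wide (atom-singleton wide (contents-singleton (onlyAtom-head s))))
  (r4-closed-double wide)

onlyAtom-of-shape : ∀ {C} → SingletonShape C → SingletonCohort C → OnlyAtomInCohort ⟨ C ⟩
onlyAtom-of-shape (inj₁ pc) _ = onlyAtom-head (enclosed-singleton (inj₂ pc))
onlyAtom-of-shape (inj₂ (inj₁ (⟨ _ ⟩ , pc , refl))) s = onlyAtom-doubled (power-wide pc) s
onlyAtom-of-shape (inj₂ (inj₂ (⟨ _ ⟩ , hollowOrPower , refl))) s =
  onlyAtom-peeled (hollowOrWide-of hollowOrPower) s

hollow-or-singleton-contents : ∀ {C} → OnlyAtomInCohort ⟨ C ⟩ →
                               ⟨ C ⟩ ≡ ⟨ [] ⟩ ⊎ (NonEmpty C × SingletonCohort C)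
hollow-or-singleton-contents {[]}    _  = inj₁ refl
hollow-or-singleton-contents {_ ∷ _} oa = inj₂ ((λ ()) , contents-singleton oa)

mainTheorem8 :
    ((A : ArchSystem) → NonEmpty A →
      SingletonCohort A ⇔
        (IsPowerCase A
        ⊎ (Σ Atom λ a → IsPowerCase (contents a) × (A ≡ a ∷ a ∷ []))
        ⊎ (Σ Atom λ a → (contents a ≡ [] ⊎ IsPowerCase (contents a)) × (A ≡ atom a))))
    ×
    ((t : Atom) →
      OnlyAtomInCohort t ⇔
        (t ≡ ⟨ [] ⟩ ⊎ (NonEmpty (contents t) × SingletonCohort (contents t))))
mainTheorem8 =
  (λ A ne → mk⇔ (shape-of-singleton A ne) singleton-of-shape) ,
  λ { ⟨ C ⟩ → mk⇔ hollow-or-singleton-contents λ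
        { (inj₁ refl)     → onlyAtom-⟨⟩
        ; (inj₂ (ne , s)) → onlyAtom-of-shape (shape-of-singleton C ne s) s } }
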